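{- For every integer $k\ge 2$, $P_5\not\le K_{1,k}+e$. In particular, $P_5\not\le K_{1,k}$.
   Context: All graphs are finite and simple, considered up to isomorphism. An edge-colored graph is a pair $(G,c)$ with $c\colon E(G)\to\mathbb{N}$ an arbitrary map (not necessarily proper); it is colored in $t$ or more colors if $|c(E(G))|\ge t$. A subgraph (not necessarily induced) is rainbow if its edges receive pairwise distinct colors. $(G,c)$ is rainbow $H$-free if $G$ contains no rainbow subgraph isomorphic to $H$. For graphs $H_1,H_2$, write $H_1\le H_2$ if there is a positive integer $t$ such that every rainbow $H_1$-free edge-colored complete graph colored in $t$ or more colors is rainbow $H_2$-free. $P_5$ is the path on $5$ vertices. $K_{1,k}$ is the star with $k$ leaves, and $K_{1,k}+e$ is the graph obtained from $K_{1,k}$ by adding one edge between two of its leaves. -}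

module Defs where

open import Data.Nat using (ℕ; zero; suc; _<_)
open import Data.Fin using (Fin; zero; suc)
open import Data.List using (List; []; _∷_; length; lookup)
open import Data.List.Base using (tabulate)
open import Data.Product using (Σ; ∃; _×_; _,_; proj₁; proj₂)
open import Relation.Nullary using (¬_)
open import Relation.Binary.PropositionalEquality using (_≡_; _≢_)
open import Function.Definitions using (Injective)

-- A finite (simple) graph: vertex set Fin V and a list of edges (each edge listed once).
record Graph : Set where
  constructor mkGraph
  field
    V : ℕ
    E : List (Fin V × Fin V)
open Graph public

-- An edge-colouring of the complete graph K_n: colour of edge {u,v} is c u v
-- (the diagonal values c u u are irrelevant); symmetric.
Coloring : ℕ → Set
Coloring n = Fin n → Fin n → ℕ

Symmetric : ∀ {n} → Coloring n → Set
Symmetric {n} c = ∀ (u v : Fin n) → c u v ≡ c v u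

col : ∀ {n} → Coloring n → Fin n × Fin n → ℕ
col c (u , v) = c u v

-- (K_n, c) is coloured in t or more colours: there are t edges of K_n
-- receiving pairwise distinct colours (i.e. |c(E(K_n))| ≥ t).
ColoredInAtLeast : (t : ℕ) → ∀ {n} → Coloring n → Set
ColoredInAtLeast t {n} c =
  Σ (Fin t → Fin n × Fin n) λ e →
    (∀ i → proj₁ (e i) ≢ proj₂ (e i)) ×
    (∀ i j → i ≢ j → col c (e i) ≢ col c (e j))

-- A rainbow copy of H in (K_n, c): an injective vertex map f (its image
-- with the image edges is a subgraph of K_n isomorphic to H) whose
-- edges have pairwise distinct colours.
RainbowCopy : (H : Graph) → ∀ {n} → Coloring n → Set
RainbowCopy H {n} c =
  Σ (Fin (V H) → Fin n) λ f →
    Injective _≡_ _≡_ f ×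
    (∀ (i j : Fin (length (E H))) → i ≢ j →
       c (f (proj₁ (lookup (E H) i))) (f (proj₂ (lookup (E H) i)))
         ≢ c (f (proj₁ (lookup (E H) j))) (f (proj₂ (lookup (E H) j))))

RainbowFree : (H : Graph) → ∀ {n} → Coloring n → Set
RainbowFree H c = ¬ RainbowCopy H c

_≼_ : Graph → Graph → Set
H₁ ≼ H₂ = Σ ℕ λ t → 0 < t ×
  (∀ (n : ℕ) (c : Coloring n) → Symmetric c → ColoredInAtLeast t c →
     RainbowFree H₁ c → RainbowFree H₂ c)

P5 : Graph
P5 = mkGraph 5
  ((zero , suc zero) ∷ (suc zero , suc (suc zero)) ∷
   (suc (suc zero) , suc (suc (suc zero))) ∷
   (suc (suc (suc zero)) , suc (suc (suc (suc zero)))) ∷ [])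

starEdges : (k : ℕ) → List (Fin (suc k) × Fin (suc k))
starEdges k = tabulate {n = k} (λ i → (zero , suc i))

Star : ℕ → Graph
Star k = mkGraph (suc k) (starEdges k)

-- K_{1,k}+e: K_{1,k} plus the edge between leaves 1 and 2 (only meaningful
-- for k ≥ 2; for k < 2 it is set to K_{1,k}, a case never used).
StarPlusE : ℕ → Graph
StarPlusE (suc (suc m)) =
  mkGraph (suc (suc (suc m)))
    ((suc zero , suc (suc zero)) ∷ starEdges (suc (suc m)))
StarPlusE k = Star k

{-# OPTIONS --safe #-}
-- Colour the edges of K_{N+1} at the vertex 0 with the distinct colours 1, …, N and
-- every other edge with 0.  A path P₅ visits 0 at most once, so at most two of its four
-- edges get a non-zero colour and two of them share the colour 0: the colouring is
-- rainbow P₅-free.  Yet it uses N + 1 colours, with N arbitrarily large, and for k ≤ N it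
-- contains a rainbow K_{1,k} centred at 0 and a rainbow K_{1,k}+e, whose extra edge gets
-- the colour 0.
module Submission where

open import Defs
open import Data.Empty using (⊥)
open import Data.Nat using (ℕ; _≤_; zero; suc; _+_; s≤s)
open import Data.Nat.Properties using (suc-injective)
open import Data.Fin using (Fin; zero; suc; toℕ; cast; lift; _↑ˡ_; _↑ʳ_; _≟_; #_)
open import Data.Fin.Properties
  using (toℕ-injective; toℕ-cast; lift-injective; ↑ˡ-injective; ↑ʳ-injective)
open import Data.List using (length; lookup; tabulate)
open import Data.List.Properties using (length-tabulate)
open import Data.Product using (Σ; ∃-syntax; _×_; _,_)
open import Function using (_∘_)
open import Function.Definitions using (Injective)
open import Relation.Nullary using (¬_; Dec; yes; no)
open import Relation.Binary.PropositionalEquality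

counterexamples⇒≰ : ∀ {H₁ H₂} →
  (∀ t → ∃[ n ] Σ (Coloring n) λ c →
           Symmetric c × ColoredInAtLeast t c × RainbowFree H₁ c × RainbowCopy H₂ c) →
  ¬ (H₁ ≼ H₂)
counterexamples⇒≰ counterexample (t , _ , H₁-free⇒H₂-free)
  with n , c , c-symmetric , c-coloredIn , H₁-free , H₂-copy ← counterexample t
  = H₁-free⇒H₂-free n c c-symmetric c-coloredIn H₁-free H₂-copy

imageColour : ∀ {m n} → Coloring n → (Fin m → Fin n) → Fin m × Fin m → ℕ
imageColour c f (u , v) = c (f u) (f v)

rainbowCopy : ∀ H {n} (c : Coloring n) (f : Fin (V H) → Fin n) → Injective _≡_ _≡_ f →
              Injective _≡_ _≡_ (imageColour c f ∘ lookup (E H)) → RainbowCopy H c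
rainbowCopy H c f f-injective colour-injective =
  f , f-injective , λ i j i≢j → i≢j ∘ colour-injective

cast-injective : ∀ {m n} .(eq : m ≡ n) → Injective _≡_ _≡_ (cast eq)
cast-injective eq {i} {j} castᵢ≡castⱼ = toℕ-injective (begin
  toℕ i            ≡⟨ toℕ-cast eq i ⟨
  toℕ (cast eq i)  ≡⟨ cong toℕ castᵢ≡castⱼ ⟩
  toℕ (cast eq j)  ≡⟨ toℕ-cast eq j ⟩
  toℕ j            ∎)
  where open ≡-Reasoning

lookup-tabulate-cast : ∀ {A : Set} {n} (f : Fin n → A) (i : Fin (length (tabulate f))) →
                       lookup (tabulate f) i ≡ f (cast (length-tabulate f) i)
lookup-tabulate-cast {n = suc n} f zero    = refl
lookup-tabulate-cast {n = suc n} f (suc i) = lookup-tabulate-cast (f ∘ suc) i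

rainbowStarColoring : ∀ {n} → Coloring n
rainbowStarColoring zero    v       = toℕ v
rainbowStarColoring (suc u) zero    = suc (toℕ u)
rainbowStarColoring (suc u) (suc v) = 0

rainbowStarColoring-symmetric : ∀ {n} → Symmetric (rainbowStarColoring {n})
rainbowStarColoring-symmetric zero    zero    = refl
rainbowStarColoring-symmetric zero    (suc v) = refl
rainbowStarColoring-symmetric (suc u) zero    = refl
rainbowStarColoring-symmetric (suc u) (suc v) = refl

rainbowStarColoring-offCentre : ∀ {n} {u v : Fin (suc n)} → u ≢ zero → v ≢ zero →
                                rainbowStarColoring u v ≡ 0
rainbowStarColoring-offCentre {u = zero}          u≢0 _   with () ← u≢0 refl
rainbowStarColoring-offCentre {u = suc u} {zero}  _   v≢0 with () ← v≢0 refl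
rainbowStarColoring-offCentre {u = suc u} {suc v} _   _   = refl

offCentre-sameColour :
  ∀ {n} {u v u′ v′ : Fin (suc n)} → u ≢ zero → v ≢ zero → u′ ≢ zero → v′ ≢ zero →
  rainbowStarColoring u v ≡ rainbowStarColoring u′ v′
offCentre-sameColour u≢0 v≢0 u′≢0 v′≢0 =
  trans (rainbowStarColoring-offCentre u≢0 v≢0) (sym (rainbowStarColoring-offCentre u′≢0 v′≢0))

P5-rainbowFree : ∀ {n} → RainbowFree P5 (rainbowStarColoring {n})
P5-rainbowFree {zero}  (f , _) with () ← f (# 0)
P5-rainbowFree {suc n} (f , f-injective , rainbow) =
  clash (f (# 1) ≟ zero) (f (# 2) ≟ zero) (f (# 3) ≟ zero)
  where
  avoids : ∀ {i j} → f j ≡ zero → i ≢ j → f i ≢ zero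
  avoids fⱼ≡0 i≢j fᵢ≡0 = i≢j (f-injective (trans fᵢ≡0 (sym fⱼ≡0)))

  -- Edge i of P₅ joins the vertices i and i + 1.
  clash : Dec (f (# 1) ≡ zero) → Dec (f (# 2) ≡ zero) → Dec (f (# 3) ≡ zero) → ⊥
  clash (yes f₁≡0) _ _ =
    rainbow (# 2) (# 3) (λ ()) (offCentre-sameColour (avoids f₁≡0 (λ ())) (avoids f₁≡0 (λ ()))
                                                     (avoids f₁≡0 (λ ())) (avoids f₁≡0 (λ ())))
  clash (no _) (yes f₂≡0) _ =
    rainbow (# 0) (# 3) (λ ()) (offCentre-sameColour (avoids f₂≡0 (λ ())) (avoids f₂≡0 (λ ()))
                                                     (avoids f₂≡0 (λ ())) (avoids f₂≡0 (λ ())))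
  clash (no _) (no _) (yes f₃≡0) =
    rainbow (# 0) (# 1) (λ ()) (offCentre-sameColour (avoids f₃≡0 (λ ())) (avoids f₃≡0 (λ ()))
                                                     (avoids f₃≡0 (λ ())) (avoids f₃≡0 (λ ())))
  clash (no f₁≢0) (no f₂≢0) (no f₃≢0) =
    rainbow (# 1) (# 2) (λ ()) (offCentre-sameColour f₁≢0 f₂≢0 f₂≢0 f₃≢0)

rainbowStarColoring-coloredIn : ∀ {t N} (g : Fin t → Fin N) → Injective _≡_ _≡_ g →
                                ColoredInAtLeast t (rainbowStarColoring {suc N})
rainbowStarColoring-coloredIn g g-injective =
  (λ i → zero , suc (g i)) , (λ i ()) ,
  λ i j i≢j same → i≢j (g-injective (toℕ-injective (suc-injective same)))

spokeIndex : ∀ {k} → Fin (length (starEdges k)) → Fin k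
spokeIndex {k} = cast (length-tabulate {n = k} (λ i → zero , suc i))

lookup-starEdges : ∀ {k} (i : Fin (length (starEdges k))) →
                   lookup (starEdges k) i ≡ (zero , suc (spokeIndex i))
lookup-starEdges = lookup-tabulate-cast (λ i → zero , suc i)

spokeColour : ∀ {k N} (g : Fin k → Fin N) (i : Fin (length (starEdges k))) →
              imageColour rainbowStarColoring (lift 1 g) (lookup (starEdges k) i)
                ≡ suc (toℕ (g (spokeIndex i)))
spokeColour g i = cong (imageColour rainbowStarColoring (lift 1 g)) (lookup-starEdges i)

spokeColour-injective : ∀ {k N} (g : Fin k → Fin N) → Injective _≡_ _≡_ g →
  Injective _≡_ _≡_ (imageColour rainbowStarColoring (lift 1 g) ∘ lookup (starEdges k))
spokeColour-injective {k} {N} g g-injective {i} {j} same =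
  cast-injective (length-tabulate {n = k} _) (g-injective (toℕ-injective (suc-injective (begin
    suc (toℕ (g (spokeIndex i)))                      ≡⟨ spokeColour g i ⟨
    imageColour c (lift 1 g) (lookup (starEdges k) i) ≡⟨ same ⟩
    imageColour c (lift 1 g) (lookup (starEdges k) j) ≡⟨ spokeColour g j ⟩
    suc (toℕ (g (spokeIndex j)))                      ∎))))
  where
  open ≡-Reasoning
  c : Coloring (suc N)
  c = rainbowStarColoring

Star-rainbowCopy : ∀ {k N} (g : Fin k → Fin N) → Injective _≡_ _≡_ g →
                   RainbowCopy (Star k) (rainbowStarColoring {suc N})
Star-rainbowCopy {k} g g-injective =
  rainbowCopy (Star k) rainbowStarColoring (lift 1 g) (lift-injective g g-injective 1)
              (spokeColour-injective g g-injective)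

StarPlusE-rainbowCopy : ∀ {m N} (g : Fin (2 + m) → Fin N) → Injective _≡_ _≡_ g →
                        RainbowCopy (StarPlusE (2 + m)) (rainbowStarColoring {suc N})
StarPlusE-rainbowCopy {m} g g-injective =
  rainbowCopy (StarPlusE (2 + m)) rainbowStarColoring (lift 1 g) (lift-injective g g-injective 1)
              colour-injective
  where
  colour-injective : Injective _≡_ _≡_
    (imageColour rainbowStarColoring (lift 1 g) ∘ lookup (E (StarPlusE (2 + m))))
  colour-injective {zero}  {zero}  _    = refl
  colour-injective {zero}  {suc j} same with () ← trans same (spokeColour g j)
  colour-injective {suc i} {zero}  same with () ← trans (sym same) (spokeColour g i)
  colour-injective {suc i} {suc j} same = cong suc (spokeColour-injective g g-injective same)

lemma17 : ∀ (k : ℕ) → 2 ≤ k → ¬ (P5 ≼ StarPlusE k) × ¬ (P5 ≼ Star k)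
lemma17 k@(suc (suc _)) (s≤s (s≤s _)) =
  refutedBy (λ t → StarPlusE-rainbowCopy (_↑ˡ t) (↑ˡ-injective t _ _)) ,
  refutedBy (λ t → Star-rainbowCopy (_↑ˡ t) (↑ˡ-injective t _ _))
  where
  refutedBy : ∀ {H} → (∀ t → RainbowCopy H (rainbowStarColoring {suc (k + t)})) → ¬ (P5 ≼ H)
  refutedBy {H} H-copy = counterexamples⇒≰ {P5} {H} λ t →
    suc (k + t) , rainbowStarColoring , rainbowStarColoring-symmetric ,
    rainbowStarColoring-coloredIn (k ↑ʳ_) (↑ʳ-injective k _ _) , P5-rainbowFree , H-copy t
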